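{- Let $\mathcal{L}=\{x,y,z,t,u,v\}$ and let $\mathcal{C}=\{a,b,c,d,e\}$ be the following five $4$-state full characters on $\mathcal{L}$: $a=\{x,u\}\,|\,\{z,t\}\,|\,\{y\}\,|\,\{v\}$, $b=\{x,y\}\,|\,\{t,v\}\,|\,\{z\}\,|\,\{u\}$, $c=\{y,z\}\,|\,\{u,v\}\,|\,\{x\}\,|\,\{t\}$, $d=\{x,u\}\,|\,\{y,z\}\,|\,\{t\}\,|\,\{v\}$, $e=\{z,t\}\,|\,\{u,v\}\,|\,\{x\}\,|\,\{y\}$. Then $\mathcal{C}$ is not compatible, but every subset of $\mathcal{C}$ consisting of four characters is compatible. In particular, there is a set of $4$-state full characters which is not compatible although every $4$ of its characters are compatible.
   Context: A character on a finite species set $\mathcal{L}$ is a partition of a nonempty subset of $\mathcal{L}$; its parts are its states. It is full if it partitions all of $\mathcal{L}$, and it is an $r$-state character if it has at most $r$ parts. A phylogenetic tree on $\mathcal{L}$ is a tree whose leaves are labelled bijectively by the elements of $\mathcal{L}$. A character $c$ with parts $P_0,\dots,P_{r-1}$ is convex on a phylogenetic tree $T$ if the minimal subtrees $T(P_0),\dots,T(P_{r-1})$ of $T$ spanning the leaves in $P_0,\dots,P_{r-1}$ respectively are pairwise vertex-disjoint. A set of characters is compatible if there is a phylogenetic tree on $\mathcal{L}$ on which every character of the set is convex. -}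

module Defs where

open import Data.Nat using (ℕ; zero; suc; _≤_)
open import Data.Fin using (Fin; zero; suc)
open import Data.Bool using (Bool; true; false; T)
open import Data.List using (List; []; _∷_; length; filterᵇ; allFin)
open import Data.List.Relation.Unary.All using (All)
open import Data.List.Relation.Unary.Unique.Propositional using (Unique)
open import Data.Product using (Σ; ∃; _×_; _,_)
open import Relation.Binary.PropositionalEquality using (_≡_; _≢_)
open import Relation.Nullary using (¬_)

data Walk {n : ℕ} (adj : Fin n → Fin n → Bool) : Fin n → Fin n → Set where
  here : ∀ {v} → Walk adj v v
  step : ∀ {u w v} → T (adj u w) → Walk adj w v → Walk adj u v

vertices : ∀ {n} {adj : Fin n → Fin n → Bool} {u v} → Walk adj u v → List (Fin n)
vertices {u = u} here = u ∷ []
vertices {u = u} (step _ p) = u ∷ vertices p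

Connected : ∀ {n} → (Fin n → Fin n → Bool) → (Fin n → Bool) → Set
Connected {n} adj S =
  (u v : Fin n) → T (S u) → T (S v) →
  Σ (Walk adj u v) (λ p → All (λ w → T (S w)) (vertices p))

-- A cycle: distinct vertices w = v₁, …, v_k = u (k ≥ 3), consecutive ones
-- adjacent, and u adjacent to w.
HasCycle : ∀ {n} → (Fin n → Fin n → Bool) → Set
HasCycle {n} adj =
  Σ (Fin n) λ u → Σ (Fin n) λ w → T (adj u w) ×
  Σ (Walk adj w u) (λ p → Unique (vertices p) × (3 ≤ length (vertices p)))

degree : ∀ {n} → (Fin n → Fin n → Bool) → Fin n → ℕ
degree {n} adj v = length (filterᵇ (adj v) (allFin n))

IsLeaf : ∀ {n} → (Fin n → Fin n → Bool) → Fin n → Set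
IsLeaf adj v = degree adj v ≤ 1

-- Species set 𝓛 = {x, y, z, t, u, v} encoded as Fin 6 in this order.

Species : Set
Species = Fin 6

record PhyloTree : Set where
  field
    n          : ℕ
    adj        : Fin n → Fin n → Bool
    irrefl     : (v : Fin n) → adj v v ≡ false
    symmetric  : (u v : Fin n) → adj u v ≡ adj v u
    connected  : Connected adj (λ _ → true)
    acyclic    : ¬ HasCycle adj
    label      : Species → Fin n
    label-inj  : (i j : Species) → label i ≡ label j → i ≡ j
    label-leaf : (i : Species) → IsLeaf adj (label i)
    leaf-label : (v : Fin n) → IsLeaf adj v → Σ Species (λ i → label i ≡ v)

open PhyloTree public

-- Full r-state characters are represented by their state assignment
-- χ : 𝓛 → Fin r; the parts (states) are the nonempty fibres of χ.

Character : ℕ → Set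
Character r = Species → Fin r

-- Vertex w lies in the minimal subtree T(P_s) spanning the leaves of state s:
-- w belongs to every connected vertex set containing all those leaves.
InSpan : (T' : PhyloTree) {r : ℕ} → Character r → Fin r → Fin (n T') → Set
InSpan T' χ s w =
  (S : Fin (n T') → Bool) → Connected (adj T') S →
  ((ℓ : Species) → χ ℓ ≡ s → T (S (label T' ℓ))) →
  T (S w)

Convex : (T' : PhyloTree) {r : ℕ} → Character r → Set
Convex T' {r} χ =
  (s s' : Fin r) → s ≢ s' → (w : Fin (n T')) →
  ¬ (InSpan T' χ s w × InSpan T' χ s' w)

Compatible : {I : Set} {r : ℕ} → (I → Character r) → Set
Compatible {I} χs = Σ PhyloTree (λ T' → (i : I) → Convex T' (χs i))

sx sy sz st su sv : Species
sx = zero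
sy = suc zero
sz = suc (suc zero)
st = suc (suc (suc zero))
su = suc (suc (suc (suc zero)))
sv = suc (suc (suc (suc (suc zero))))

s0 s1 s2 s3 : Fin 4
s0 = zero
s1 = suc zero
s2 = suc (suc zero)
s3 = suc (suc (suc zero))

-- a = {x,u} | {z,t} | {y} | {v}
charA : Character 4
charA zero = s0
charA (suc zero) = s2
charA (suc (suc zero)) = s1
charA (suc (suc (suc zero))) = s1
charA (suc (suc (suc (suc zero)))) = s0
charA (suc (suc (suc (suc (suc zero))))) = s3

-- b = {x,y} | {t,v} | {z} | {u}
charB : Character 4
charB zero = s0
charB (suc zero) = s0
charB (suc (suc zero)) = s2
charB (suc (suc (suc zero))) = s1
charB (suc (suc (suc (suc zero)))) = s3
charB (suc (suc (suc (suc (suc zero))))) = s1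

-- c = {y,z} | {u,v} | {x} | {t}
charC : Character 4
charC zero = s2
charC (suc zero) = s0
charC (suc (suc zero)) = s0
charC (suc (suc (suc zero))) = s3
charC (suc (suc (suc (suc zero)))) = s1
charC (suc (suc (suc (suc (suc zero))))) = s1

-- d = {x,u} | {y,z} | {t} | {v}
charD : Character 4
charD zero = s0
charD (suc zero) = s1
charD (suc (suc zero)) = s1
charD (suc (suc (suc zero))) = s2
charD (suc (suc (suc (suc zero)))) = s0
charD (suc (suc (suc (suc (suc zero))))) = s3

-- e = {z,t} | {u,v} | {x} | {y}
charE : Character 4
charE zero = s2
charE (suc zero) = s3
charE (suc (suc zero)) = s0
charE (suc (suc (suc zero))) = s0
charE (suc (suc (suc (suc zero)))) = s1
charE (suc (suc (suc (suc (suc zero))))) = s1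

chars : Fin 5 → Character 4
chars zero = charA
chars (suc zero) = charB
chars (suc (suc zero)) = charC
chars (suc (suc (suc zero))) = charD
chars (suc (suc (suc (suc zero)))) = charE

module Submission where

-- Incompatibility is a median argument.  In an acyclic graph a simple path is determined by
-- its endpoints (Walks.Acyclic), so in a tree the path a–c is covered by the paths a–b and
-- b–c, and any three vertices have a median lying on all three pairwise paths (TreePaths).
-- A convex character makes the path between two leaves of one state disjoint from the path
-- between two leaves of another state (TreePaths.separated); following the median of y, x, t
-- through the five characters gives a contradiction (incompatible).
--
-- Compatibility of each four is shown by explicit trees.  A tree is presented by a parent
-- function whose depth grows by one from parent to child; such a graph is acyclic and every
-- up-closed vertex set in it is connected (RootedTrees).  A character is convex once its states
-- lie in pairwise disjoint connected vertex sets (convex-by-separation).  For each omitted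
-- character we give a ten-vertex tree and, for the other four characters, a top vertex for
-- each state; the remaining finite conditions are verified by decision procedures.

open import Defs
open import Data.Bool using (Bool; true; false; T; not; _∧_; _∨_; if_then_else_)
open import Data.Bool.Properties using (∨-comm; T-∨)
open import Data.Empty using (⊥; ⊥-elim)
open import Data.Fin using (Fin; zero; suc; _≟_; _↑ˡ_; #_)
open import Data.Fin.Properties using (all?; any?; ↑ˡ-injective)
open import Data.List using (List; []; _∷_; _∷ʳ_; length; reverse)
open import Data.List.Properties using (unfold-reverse; length-reverse; length-++)
open import Data.List.Membership.Propositional using (_∈_; _∉_)
import Data.List.Membership.DecPropositional as DecMembership
open import Data.List.Relation.Binary.Subset.Propositional using (_⊆_)
open import Data.List.Relation.Unary.All as All using (All)
open import Data.List.Relation.Unary.All.Properties using (¬Any⇒All¬)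
import Data.List.Relation.Unary.Any as Any
open import Data.List.Relation.Unary.Any.Properties using (reverse⁻)
open import Data.List.Relation.Unary.AllPairs as AllPairs using ()
open import Data.List.Relation.Unary.Unique.Propositional using (Unique)
open import Data.List.Relation.Unary.Unique.Propositional.Properties
  using (++⁺; Unique[x∷xs]⇒x∉xs)
open import Data.Nat using (ℕ; zero; suc; _+_; _≤_; _≤?_; z≤n; s≤s)
import Data.Nat as ℕ
open import Data.Nat.Properties using (+-monoˡ-≤; ≤-refl; n≤1+n; 1+n≢n; 1+n≰n; 0≢1+n; suc-injective; module ≤-Reasoning)
open import Data.Product using (Σ; _×_; _,_; proj₁; proj₂)
open import Data.Sum using (_⊎_; inj₁; inj₂)
import Data.Sum as Sum
open import Data.Unit using (⊤; tt)
open import Data.Vec using (Vec; []; _∷_; lookup)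
open import Data.Maybe using (Maybe; nothing; just)
open import Function using (_∘_; Equivalence)
open import Relation.Binary.PropositionalEquality
  using (_≡_; _≢_; refl; sym; trans; cong; subst; module ≡-Reasoning)
open import Relation.Nullary using (¬_; Dec; yes; no)
open import Relation.Nullary.Decidable using (⌊_⌋; from-yes; T?; ¬?; _×-dec_; _⊎-dec_; _→-dec_)

module ListFacts {A : Set} where

  Unique-tail : ∀ {x : A} {xs} → Unique (x ∷ xs) → Unique xs
  Unique-tail (_ AllPairs.∷ u) = u

  Unique-∷ : ∀ {x : A} {xs} → x ∉ xs → Unique xs → Unique (x ∷ xs)
  Unique-∷ {xs = xs} x∉xs u = ¬Any⇒All¬ xs x∉xs AllPairs.∷ u

  Unique-∷ʳ : ∀ {x : A} {xs} → x ∉ xs → Unique xs → Unique (xs ∷ʳ x)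
  Unique-∷ʳ x∉xs u = ++⁺ u (All.[] AllPairs.∷ AllPairs.[])
    λ { (m , Any.here refl) → x∉xs m }

  Unique-reverse : ∀ {xs : List A} → Unique xs → Unique (reverse xs)
  Unique-reverse {[]} u = u
  Unique-reverse {x ∷ xs} u =
    subst Unique (sym (unfold-reverse x xs))
      (Unique-∷ʳ (Unique[x∷xs]⇒x∉xs u ∘ reverse⁻) (Unique-reverse (Unique-tail u)))

open ListFacts

module Walks {n : ℕ} (adj : Fin n → Fin n → Bool) where

  private variable a b c d v x y t : Fin n

  Simple : Walk adj a b → Set
  Simple p = Unique (vertices p)

  infixr 5 _++ʷ_
  _++ʷ_ : Walk adj a b → Walk adj b c → Walk adj a c
  here     ++ʷ q = q
  step e p ++ʷ q = step e (p ++ʷ q)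

  start∈ : (p : Walk adj a b) → a ∈ vertices p
  start∈ here       = Any.here refl
  start∈ (step _ _) = Any.here refl

  end∈ : (p : Walk adj a b) → b ∈ vertices p
  end∈ here       = Any.here refl
  end∈ (step _ p) = Any.there (end∈ p)

  ∈-++ʷ⁻ : (p : Walk adj a b) (q : Walk adj b c) →
           v ∈ vertices (p ++ʷ q) → v ∈ vertices p ⊎ v ∈ vertices q
  ∈-++ʷ⁻ here       q m              = inj₂ m
  ∈-++ʷ⁻ (step e p) q (Any.here eq)  = inj₁ (Any.here eq)
  ∈-++ʷ⁻ (step e p) q (Any.there m)  = Sum.map₁ Any.there (∈-++ʷ⁻ p q m)

  vertices-∷ʳ : (p : Walk adj a b) (e : T (adj b c)) →
                vertices (p ++ʷ step e here) ≡ vertices p ∷ʳ c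
  vertices-∷ʳ here       e = refl
  vertices-∷ʳ (step _ p) e = cong (_ ∷_) (vertices-∷ʳ p e)

  suffixFrom : (p : Walk adj a b) → v ∈ vertices p →
               Σ (Walk adj v b) λ q → vertices q ⊆ vertices p × (Simple p → Simple q)
  suffixFrom here       (Any.here refl) = here , (λ m → m) , (λ s → s)
  suffixFrom (step e p) (Any.here refl) = step e p , (λ m → m) , (λ s → s)
  suffixFrom (step e p) (Any.there m) with suffixFrom p m
  ... | q , q⊆p , simple = q , Any.there ∘ q⊆p , simple ∘ Unique-tail

  shortcut : (p : Walk adj a b) → Σ (Walk adj a b) λ q → Simple q × vertices q ⊆ vertices p
  shortcut here = here , All.[] AllPairs.∷ AllPairs.[] , (λ m → m)
  shortcut (step {u = a} e p) with shortcut p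
  ... | q , simple-q , q⊆p with DecMembership._∈?_ _≟_ a (vertices q)
  ...   | yes a∈q = let (r , r⊆q , simple-r) = suffixFrom q a∈q
                    in r , simple-r simple-q , Any.there ∘ q⊆p ∘ r⊆q
  ...   | no a∉q  = step e q , Unique-∷ a∉q simple-q ,
                    λ { (Any.here eq) → Any.here eq ; (Any.there m) → Any.there (q⊆p m) }

  record Junction (σ : Walk adj y x) (π : Walk adj x t) : Set where
    field
      vertex    : Fin n
      on-σ      : vertex ∈ vertices σ
      on-π      : vertex ∈ vertices π
      bridge    : Walk adj y t
      simple    : Simple bridge
      on-bridge : vertex ∈ vertices bridge
      bridge⊆   : ∀ {w} → w ∈ vertices bridge → w ∈ vertices σ ⊎ w ∈ vertices π

  -- The junction is the first vertex of σ lying on π: follow σ up to it, then π.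
  junction : (σ : Walk adj y x) (π : Walk adj x t) → Simple σ → Simple π → Junction σ π
  junction {x = x} here π _ simple-π = record
    { vertex = x ; on-σ = Any.here refl ; on-π = start∈ π
    ; bridge = π ; simple = simple-π ; on-bridge = start∈ π ; bridge⊆ = inj₂ }
  junction (step {u = y} e σ) π simple-σ simple-π with DecMembership._∈?_ _≟_ y (vertices π)
  ... | yes y∈π = let (τ , τ⊆π , simple-τ) = suffixFrom π y∈π in record
    { vertex = y ; on-σ = Any.here refl ; on-π = y∈π
    ; bridge = τ ; simple = simple-τ simple-π ; on-bridge = start∈ τ ; bridge⊆ = inj₂ ∘ τ⊆π }
  ... | no y∉π = record
    { vertex = vertex ; on-σ = Any.there on-σ ; on-π = on-π
    ; bridge = step e bridge ; simple = Unique-∷ y∉bridge simple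
    ; on-bridge = Any.there on-bridge ; bridge⊆ = step⊆ }
    where
    open Junction (junction σ π (Unique-tail simple-σ) simple-π)
    y∉bridge : y ∉ vertices bridge
    y∉bridge m with bridge⊆ m
    ... | inj₁ y∈σ = Unique[x∷xs]⇒x∉xs simple-σ y∈σ
    ... | inj₂ y∈π = y∉π y∈π
    step⊆ : ∀ {w} → w ∈ vertices (step e bridge) → w ∈ vertices (step e σ) ⊎ w ∈ vertices π
    step⊆ (Any.here eq) = inj₁ (Any.here eq)
    step⊆ (Any.there m) = Sum.map₁ Any.there (bridge⊆ m)

  module Reversal (adj-sym : ∀ {a b} → T (adj a b) → T (adj b a)) where

    reverseʷ : Walk adj a b → Walk adj b a
    reverseʷ here       = here
    reverseʷ (step e p) = reverseʷ p ++ʷ step (adj-sym e) here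

    vertices-reverseʷ : (p : Walk adj a b) → vertices (reverseʷ p) ≡ reverse (vertices p)
    vertices-reverseʷ here = refl
    vertices-reverseʷ (step {u = a} e p) = begin
      vertices (reverseʷ p ++ʷ step (adj-sym e) here) ≡⟨ vertices-∷ʳ (reverseʷ p) (adj-sym e) ⟩
      vertices (reverseʷ p) ∷ʳ a                      ≡⟨ cong (_∷ʳ a) (vertices-reverseʷ p) ⟩
      reverse (vertices p) ∷ʳ a                       ≡⟨ unfold-reverse a (vertices p) ⟨
      reverse (a ∷ vertices p)                        ∎
      where open ≡-Reasoning

    ∈-reverseʷ⁻ : (p : Walk adj a b) → v ∈ vertices (reverseʷ p) → v ∈ vertices p
    ∈-reverseʷ⁻ p = reverse⁻ ∘ subst (_ ∈_) (vertices-reverseʷ p)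

    Simple-reverseʷ : (p : Walk adj a b) → Simple p → Simple (reverseʷ p)
    Simple-reverseʷ p = subst Unique (sym (vertices-reverseʷ p)) ∘ Unique-reverse

    length-reverseʷ : (p : Walk adj a b) → length (vertices (reverseʷ p)) ≡ length (vertices p)
    length-reverseʷ p = trans (cong length (vertices-reverseʷ p)) (length-reverse (vertices p))

  module Acyclic (adj-sym : ∀ {a b} → T (adj a b) → T (adj b a)) (acyclic : ¬ HasCycle adj) where
    open Reversal adj-sym

    private
      two≤length : c ≢ d → (ρ : Walk adj c d) → 2 ≤ length (vertices ρ)
      two≤length c≢d here                = ⊥-elim (c≢d refl)
      two≤length c≢d (step _ here)       = s≤s (s≤s z≤n)
      two≤length c≢d (step _ (step _ _)) = s≤s (s≤s z≤n)

    -- Two walks leaving a through distinct neighbours c ≠ d and meeting again, neither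
    -- returning to a, would close a cycle through a.
    noFork : (e : T (adj a c)) (f : T (adj a d)) → c ≢ d →
             (π : Walk adj c b) (σ : Walk adj d b) → a ∉ vertices π → a ∉ vertices σ → ⊥
    noFork {a} e f c≢d π σ a∉π a∉σ =
      acyclic (a , _ , e , ρ ++ʷ step (adj-sym f) here , simple-cycle , long)
      where
      ρs = shortcut (π ++ʷ reverseʷ σ)
      ρ = proj₁ ρs
      a∉ρ : a ∉ vertices ρ
      a∉ρ m with ∈-++ʷ⁻ π (reverseʷ σ) (proj₂ (proj₂ ρs) m)
      ... | inj₁ a∈π = a∉π a∈π
      ... | inj₂ a∈σ = a∉σ (∈-reverseʷ⁻ σ a∈σ)
      simple-cycle : Simple (ρ ++ʷ step (adj-sym f) here)
      simple-cycle = subst Unique (sym (vertices-∷ʳ ρ (adj-sym f)))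
                       (Unique-∷ʳ a∉ρ (proj₁ (proj₂ ρs)))
      long : 3 ≤ length (vertices (ρ ++ʷ step (adj-sym f) here))
      long rewrite vertices-∷ʳ ρ (adj-sym f) | length-++ (vertices ρ) {a ∷ []} =
        +-monoˡ-≤ 1 (two≤length c≢d ρ)

    simple-unique : (π σ : Walk adj a b) → Simple π → Simple σ → vertices π ⊆ vertices σ
    simple-unique here σ _ _ (Any.here refl) = start∈ σ
    simple-unique (step e π) here simple-π _ _ =
      ⊥-elim (Unique[x∷xs]⇒x∉xs simple-π (end∈ π))
    simple-unique (step e π) (step f σ) _ _ (Any.here refl) = Any.here refl
    simple-unique (step {w = c} e π) (step {w = d} f σ) simple-π simple-σ (Any.there m)
      with c ≟ d
    ... | yes refl = Any.there (simple-unique π σ (Unique-tail simple-π) (Unique-tail simple-σ) m)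
    ... | no c≢d   = ⊥-elim (noFork e f c≢d π σ (Unique[x∷xs]⇒x∉xs simple-π)
                                               (Unique[x∷xs]⇒x∉xs simple-σ))

    simple⊆walk : (π ω : Walk adj a b) → Simple π → vertices π ⊆ vertices ω
    simple⊆walk π ω simple-π =
      let (ω′ , simple-ω′ , ω′⊆ω) = shortcut ω in ω′⊆ω ∘ simple-unique π ω′ simple-π simple-ω′

module TreePaths (𝒯 : PhyloTree) where
  open Walks (adj 𝒯)

  private
    V = Fin (n 𝒯)
    variable a b c w : V

    adj-sym : ∀ {a b} → T (adj 𝒯 a b) → T (adj 𝒯 b a)
    adj-sym {a} {b} = subst T (symmetric 𝒯 a b)

  open Acyclic adj-sym (acyclic 𝒯)

  OnPath : V → V → V → Set
  OnPath a b w = Σ (Walk (adj 𝒯) a b) λ π → Simple π × w ∈ vertices π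

  path : (a b : V) → Σ (Walk (adj 𝒯) a b) Simple
  path a b = let (π , simple-π , _) = shortcut (proj₁ (connected 𝒯 a b tt tt)) in π , simple-π

  onPath-split : ∀ a b c → OnPath a c w → OnPath a b w ⊎ OnPath b c w
  onPath-split a b c (π , simple-π , w∈π)
    with path a b | path b c
  ... | ρ , simple-ρ | σ , simple-σ
    with ∈-++ʷ⁻ ρ σ (simple⊆walk π (ρ ++ʷ σ) simple-π w∈π)
  ... | inj₁ w∈ρ = inj₁ (ρ , simple-ρ , w∈ρ)
  ... | inj₂ w∈σ = inj₂ (σ , simple-σ , w∈σ)

  median : ∀ a b c → Σ V λ w → OnPath a b w × OnPath b c w × OnPath a c w
  median a b c with path a b | path b c
  ... | σ , simple-σ | π , simple-π =
    vertex , (σ , simple-σ , on-σ) , (π , simple-π , on-π) , (bridge , simple , on-bridge)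
    where open Junction (junction σ π simple-σ simple-π)

  -- The path between two leaves of state s lies in the minimal subtree spanning state s,
  -- because every connected vertex set containing both leaves contains a walk between them.
  onPath⇒inSpan : ∀ {r} (χ : Character r) {s p q} → χ p ≡ s → χ q ≡ s →
                  OnPath (label 𝒯 p) (label 𝒯 q) w → InSpan 𝒯 χ s w
  onPath⇒inSpan χ {p = p} {q} χp≡s χq≡s (π , simple-π , w∈π) S connected-S leaves-in-S =
    let (ω , ω⊆S) = connected-S (label 𝒯 p) (label 𝒯 q) (leaves-in-S p χp≡s) (leaves-in-S q χq≡s)
    in All.lookup ω⊆S (simple⊆walk π ω simple-π w∈π)

  separated : ∀ {r} {χ : Character r} → Convex 𝒯 χ → ∀ {p q p′ q′} →
              χ p ≡ χ q → χ p′ ≡ χ q′ → χ p ≢ χ p′ →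
              OnPath (label 𝒯 p) (label 𝒯 q) w → OnPath (label 𝒯 p′) (label 𝒯 q′) w → ⊥
  separated {χ = χ} convex χp≡χq χp′≡χq′ χp≢χp′ pq pq′ =
    convex _ _ χp≢χp′ _
      (onPath⇒inSpan χ refl (sym χp≡χq) pq , onPath⇒inSpan χ refl (sym χp′≡χq′) pq′)

-- Take the median m of y, x, t.  It lies on the
-- path x–t, hence on x–v or on v–t; the latter contradicts b = xy|tv since m is on y–x.
-- So m is on x–u or on u–v, and (being on y–t) on y–z or on z–t; the four combinations
-- contradict d = xu|yz, a = xu|zt, c = yz|uv and e = zt|uv respectively.
incompatible : ¬ Compatible chars
incompatible (𝒯 , convex) = contradiction
  where
  open TreePaths 𝒯
  leaf : Species → Fin (n 𝒯)
  leaf = label 𝒯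
  a b c d e : Fin 5
  a = zero
  b = suc zero
  c = suc (suc zero)
  d = suc (suc (suc zero))
  e = suc (suc (suc (suc zero)))

  contradiction : ⊥
  contradiction with median (leaf sy) (leaf sx) (leaf st)
  ... | _ , yx , xt , yt with onPath-split _ (leaf sv) _ xt
  ...   | inj₂ vt = separated (convex b) refl refl (λ ()) yx vt
  ...   | inj₁ xv with onPath-split _ (leaf su) _ xv | onPath-split _ (leaf sz) _ yt
  ...     | inj₁ xu | inj₁ yz = separated (convex d) refl refl (λ ()) xu yz
  ...     | inj₁ xu | inj₂ zt = separated (convex a) refl refl (λ ()) xu zt
  ...     | inj₂ uv | inj₁ yz = separated (convex c) refl refl (λ ()) yz uv
  ...     | inj₂ uv | inj₂ zt = separated (convex e) refl refl (λ ()) zt uv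

-- A character is convex on a tree as soon as its states lie in pairwise disjoint connected
-- vertex sets, since the minimal subtree of each state is contained in the corresponding set.
convex-by-separation : (𝒯 : PhyloTree) {r : ℕ} (χ : Character r) (S : Fin r → Fin (n 𝒯) → Bool) →
                       (∀ s → Connected (adj 𝒯) (S s)) →
                       (∀ s ℓ → χ ℓ ≡ s → T (S s (label 𝒯 ℓ))) →
                       (∀ s s′ → s ≢ s′ → ∀ w → ¬ (T (S s w) × T (S s′ w))) →
                       Convex 𝒯 χ
convex-by-separation 𝒯 χ S connected leaves disjoint s s′ s≢s′ w (w∈span-s , w∈span-s′) =
  disjoint s s′ s≢s′ w (w∈span-s (S s) (connected s) (leaves s) , w∈span-s′ (S s′) (connected s′) (leaves s′))

-- Trees presented by a parent function.  The edges join each non-root vertex to its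
-- parent; a depth function increasing by one from parent to child makes the graph a tree.
module RootedTrees {n : ℕ} (par : Fin n → Fin n) (root : Fin n) where

  private variable a b c r : Fin n

  childOf : Fin n → Fin n → Bool
  childOf a b = not ⌊ a ≟ root ⌋ ∧ ⌊ par a ≟ b ⌋

  treeAdj : Fin n → Fin n → Bool
  treeAdj a b = childOf a b ∨ childOf b a

  open Walks treeAdj

  treeAdj-sym : (a b : Fin n) → treeAdj a b ≡ treeAdj b a
  treeAdj-sym a b = ∨-comm (childOf a b) (childOf b a)

  -- In the remaining cases t : T false is absurd.
  childOf-sound : T (childOf a b) → a ≢ root × par a ≡ b
  childOf-sound {a} {b} t with a ≟ root | par a ≟ b
  ... | no a≢root | yes pa≡b = a≢root , pa≡b

  childOf-par : a ≢ root → T (childOf a (par a))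
  childOf-par {a} a≢root with a ≟ root | par a ≟ par a
  ... | yes a≡root | _        = a≢root a≡root
  ... | no _       | yes _    = tt
  ... | no _       | no pa≢pa = pa≢pa refl

  edge-sound : T (treeAdj a b) → (a ≢ root × par a ≡ b) ⊎ (b ≢ root × par b ≡ a)
  edge-sound = Sum.map childOf-sound childOf-sound ∘ Equivalence.to T-∨

  UpClosed : (Fin n → Bool) → Fin n → Set
  UpClosed S r = ∀ v → T (S v) → v ≡ r ⊎ (v ≢ root × T (S (par v)))

  upClosed? : ∀ S r → Dec (UpClosed S r)
  upClosed? S r = all? λ v → T? (S v) →-dec (v ≟ r ⊎-dec (¬? (v ≟ root) ×-dec T? (S (par v))))

  module Graded (dep : Fin n → ℕ) (graded : ∀ v → v ≢ root → dep v ≡ suc (dep (par v))) where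
    open Reversal (λ {a} {b} → subst T (treeAdj-sym a b))

    -- No vertex is its own parent, since their depths differ; so there are no loops.
    irreflexive : (v : Fin n) → treeAdj v v ≡ false
    irreflexive v with v ≟ root | par v ≟ v
    ... | yes _      | _        = refl
    ... | no _       | no _     = refl
    ... | no v≢root  | yes pv≡v = ⊥-elim (1+n≢n (trans (sym (graded v v≢root)) (cong dep (sym pv≡v))))

    FirstStepAvoids : Fin n → Walk treeAdj a b → Set
    FirstStepAvoids z here               = ⊤
    FirstStepAvoids z (step {w = c} _ _) = z ≢ c

    avoids-fresh : (p : Walk treeAdj a b) → c ∉ vertices p → FirstStepAvoids c p
    avoids-fresh here       _   = tt
    avoids-fresh (step _ p) c∉p refl = c∉p (Any.there (start∈ p))

    descend : (p : Walk treeAdj a b) → FirstStepAvoids (par a) p → Simple p → dep a ≤ dep b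
    descend here _ _ = ≤-refl
    descend {a} (step {w = c} e p) pa≢c simple with edge-sound e
    ... | inj₁ (_ , pa≡c) = ⊥-elim (pa≢c pa≡c)
    ... | inj₂ (c≢root , pc≡a) = begin
      dep a             ≤⟨ n≤1+n (dep a) ⟩
      suc (dep a)       ≡⟨ cong (suc ∘ dep) pc≡a ⟨
      suc (dep (par c)) ≡⟨ graded c c≢root ⟨
      dep c             ≤⟨ descend p avoids-a (Unique-tail simple) ⟩
      _                 ∎
      where
      open ≤-Reasoning
      avoids-a : FirstStepAvoids (par c) p
      avoids-a = subst (λ z → FirstStepAvoids z p) (sym pc≡a)
                   (avoids-fresh p (Unique[x∷xs]⇒x∉xs simple))

    -- No simple walk of length ≥ 3 leads from a child w back to its parent u: having to
    -- descend from w, it would end below w, while u lies one level above w.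
    noReturn : ∀ {w u} → w ≢ root → par w ≡ u → (p : Walk treeAdj w u) →
               Simple p → 3 ≤ length (vertices p) → ⊥
    noReturn _ _ here          _ (s≤s ())
    noReturn _ _ (step _ here) _ (s≤s (s≤s ()))
    noReturn {w} {u} w≢root pw≡u p@(step _ (step {u = c} _ q)) simple _ =
      1+n≰n (begin
        suc (dep u)       ≡⟨ cong (suc ∘ dep) pw≡u ⟨
        suc (dep (par w)) ≡⟨ graded w w≢root ⟨
        dep w             ≤⟨ descend p avoids simple ⟩
        dep u             ∎)
      where
      open ≤-Reasoning
      avoids : par w ≢ c
      avoids pw≡c = Unique[x∷xs]⇒x∉xs (Unique-tail simple)
                      (subst (_∈ vertices q) (trans (sym pw≡u) pw≡c) (end∈ q))

    -- The closing edge of a cycle joins a child to its parent; going round the cycle from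
    -- the child (reversing it if necessary) contradicts noReturn.
    treeAdj-acyclic : ¬ HasCycle treeAdj
    treeAdj-acyclic (u , w , e , p , simple , long) with edge-sound e
    ... | inj₂ (w≢root , pw≡u) = noReturn w≢root pw≡u p simple long
    ... | inj₁ (u≢root , pu≡w) =
      noReturn u≢root pu≡w (reverseʷ p) (Simple-reverseʷ p simple)
        (subst (3 ≤_) (sym (length-reverseʷ p)) long)

    climb : ∀ {S} → UpClosed S r → ∀ k v → dep v ≡ k → T (S v) →
            Σ (Walk treeAdj v r) λ p → All (T ∘ S) (vertices p)
    climb up k v dv v∈S with up v v∈S
    ... | inj₁ refl = here , v∈S All.∷ All.[]
    climb up zero v dv v∈S | inj₂ (v≢root , _) =
      ⊥-elim (0≢1+n (trans (sym dv) (graded v v≢root)))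
    climb up (suc k) v dv v∈S | inj₂ (v≢root , pv∈S) =
      let (p , p⊆S) = climb up k (par v) (suc-injective (trans (sym (graded v v≢root)) dv)) pv∈S
      in step (Equivalence.from T-∨ (inj₁ (childOf-par v≢root))) p , v∈S All.∷ p⊆S

    -- An up-closed set is connected: join two vertices through the top.
    upClosed⇒connected : ∀ {S} → UpClosed S r → Connected treeAdj S
    upClosed⇒connected {S = S} up u v u∈S v∈S
      with climb up _ u refl u∈S | climb up _ v refl v∈S
    ... | p , p⊆S | q , q⊆S = p ++ʷ reverseʷ q , All.tabulate inS
      where
      inS : ∀ {w} → w ∈ vertices (p ++ʷ reverseʷ q) → T (S w)
      inS m with ∈-++ʷ⁻ p (reverseʷ q) m
      ... | inj₁ w∈p = All.lookup p⊆S w∈p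
      ... | inj₂ w∈q = All.lookup q⊆S (∈-reverseʷ⁻ q w∈q)

    treeAdj-connected : Connected treeAdj (λ _ → true)
    treeAdj-connected = upClosed⇒connected {r = root} everything
      where
      everything : UpClosed (λ _ → true) root
      everything v _ with v ≟ root
      ... | yes v≡root = inj₁ v≡root
      ... | no v≢root  = inj₂ (v≢root , tt)

-- Rooted trees whose first six vertices are the species x, y, z, t, u, v.
module LabelledRootedTrees {k : ℕ} (par : Fin (6 + k) → Fin (6 + k)) (root : Fin (6 + k)) where
  open RootedTrees par root

  private V = Fin (6 + k)

  leafLabel : Species → V
  leafLabel i = i ↑ˡ k

  height : ℕ → V → ℕ
  height zero    _ = 0
  height (suc f) v = if ⌊ v ≟ root ⌋ then 0 else suc (height f (par v))

  depth : V → ℕ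
  depth = height (6 + k)

  WellShaped : Set
  WellShaped = (∀ v → v ≢ root → depth v ≡ suc (depth (par v)))
             × (∀ i → IsLeaf treeAdj (leafLabel i))
             × (∀ v → IsLeaf treeAdj v → Σ Species λ i → leafLabel i ≡ v)

  wellShaped? : Dec WellShaped
  wellShaped? = all? (λ v → ¬? (v ≟ root) →-dec depth v ℕ.≟ suc (depth (par v)))
         ×-dec all? (λ i → degree treeAdj (leafLabel i) ≤? 1)
         ×-dec all? (λ v → degree treeAdj v ≤? 1 →-dec any? (λ i → leafLabel i ≟ v))

  phyloTree : WellShaped → PhyloTree
  phyloTree (graded , leaves-labelled , labelled-leaves) = record
    { n = 6 + k ; adj = treeAdj ; irrefl = irreflexive ; symmetric = treeAdj-sym
    ; connected = treeAdj-connected ; acyclic = treeAdj-acyclic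
    ; label = leafLabel ; label-inj = ↑ˡ-injective k
    ; label-leaf = leaves-labelled ; leaf-label = labelled-leaves }
    where open Graded depth graded

  climbTowards : ℕ → V → V → List V
  climbTowards zero    v t = v ∷ []
  climbTowards (suc f) v t = v ∷ (if ⌊ v ≟ t ⌋ then [] else climbTowards f (par v) t)

  span : ∀ {r} → Character r → (Fin r → V) → Fin r → V → Bool
  span χ top s w =
    ⌊ any? (λ ℓ → (χ ℓ ≟ s) ×-dec (w ∈? climbTowards (6 + k) (leafLabel ℓ) (top s))) ⌋
    where open DecMembership _≟_

  SpanCertificate : ∀ {r} → Character r → (Fin r → V) → Set
  SpanCertificate χ top =
      (∀ s → UpClosed (span χ top s) (top s))
    × (∀ s ℓ → χ ℓ ≡ s → T (span χ top s (leafLabel ℓ)))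
    × (∀ s s′ → s ≢ s′ → ∀ w → ¬ (T (span χ top s w) × T (span χ top s′ w)))

  spanCertificate? : ∀ {r} (χ : Character r) (top : Fin r → V) → Dec (SpanCertificate χ top)
  spanCertificate? χ top =
          all? (λ s → upClosed? (span χ top s) (top s))
    ×-dec all? (λ s → all? λ ℓ → χ ℓ ≟ s →-dec T? (span χ top s (leafLabel ℓ)))
    ×-dec all? (λ s → all? λ s′ → ¬? (s ≟ s′) →-dec
                 all? λ w → ¬? (T? (span χ top s w) ×-dec T? (span χ top s′ w)))

  certified⇒convex : (shape : WellShaped) → ∀ {r} {χ : Character r} {top : Fin r → V} →
                     SpanCertificate χ top → Convex (phyloTree shape) χ
  certified⇒convex shape@(graded , _) {χ = χ} {top} (up-closed , leaves , disjoint) =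
    convex-by-separation (phyloTree shape) χ (span χ top)
      (λ s → upClosed⇒connected (up-closed s)) leaves disjoint
    where open Graded depth graded

-- The ten-vertex trees used for the example: vertices 0–5 are x, y, z, t, u, v, vertex 6
-- is the root, and a tree is given by the vector of parents of its vertices.
module Shape (parents : Vec (Fin 10) 10) where
  open LabelledRootedTrees {k = 4} (lookup parents) (# 6) public

  Certified : Character 4 → Maybe (Vec (Fin 10) 4) → Set
  Certified χ nothing    = ⊥
  Certified χ (just top) = SpanCertificate χ (lookup top)

  certified? : (χ : Character 4) (top : Maybe (Vec (Fin 10) 4)) → Dec (Certified χ top)
  certified? χ nothing    = no (λ ())
  certified? χ (just top) = spanCertificate? χ (lookup top)

  certified⇒convex′ : (shape : WellShaped) {χ : Character 4} (top : Maybe (Vec (Fin 10) 4)) →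
                      Certified χ top → Convex (phyloTree shape) χ
  certified⇒convex′ shape (just top) = certified⇒convex shape

record Witness : Set where
  constructor witness
  field
    parents : Vec (Fin 10) 10
    tops    : Vec (Maybe (Vec (Fin 10) 4)) 5

-- Without a: the caterpillar (y z) x t (u v).
withoutA : Witness
withoutA = witness
  (# 7 ∷ # 6 ∷ # 6 ∷ # 8 ∷ # 9 ∷ # 9 ∷ # 6 ∷ # 6 ∷ # 7 ∷ # 8 ∷ [])
  ( nothing
  ∷ just (# 6 ∷ # 8 ∷ # 2 ∷ # 4 ∷ [])
  ∷ just (# 6 ∷ # 9 ∷ # 0 ∷ # 3 ∷ [])
  ∷ just (# 7 ∷ # 6 ∷ # 3 ∷ # 5 ∷ [])
  ∷ just (# 6 ∷ # 9 ∷ # 0 ∷ # 1 ∷ [])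
  ∷ [])

-- Without b: the caterpillar (y z) t u (x v).
withoutB : Witness
withoutB = witness
  (# 9 ∷ # 6 ∷ # 6 ∷ # 7 ∷ # 8 ∷ # 9 ∷ # 6 ∷ # 6 ∷ # 7 ∷ # 8 ∷ [])
  ( just (# 8 ∷ # 6 ∷ # 1 ∷ # 5 ∷ [])
  ∷ nothing
  ∷ just (# 6 ∷ # 8 ∷ # 0 ∷ # 3 ∷ [])
  ∷ just (# 8 ∷ # 6 ∷ # 3 ∷ # 5 ∷ [])
  ∷ just (# 6 ∷ # 8 ∷ # 0 ∷ # 1 ∷ [])
  ∷ [])

-- Without c: the tree y (x u) (v (z t)) rooted at 6.
withoutC : Witness
withoutC = witness
  (# 8 ∷ # 6 ∷ # 7 ∷ # 7 ∷ # 8 ∷ # 9 ∷ # 6 ∷ # 9 ∷ # 6 ∷ # 6 ∷ [])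
  ( just (# 8 ∷ # 7 ∷ # 1 ∷ # 5 ∷ [])
  ∷ just (# 6 ∷ # 9 ∷ # 2 ∷ # 4 ∷ [])
  ∷ nothing
  ∷ just (# 8 ∷ # 6 ∷ # 3 ∷ # 5 ∷ [])
  ∷ just (# 7 ∷ # 6 ∷ # 0 ∷ # 1 ∷ [])
  ∷ [])

-- Without d: the tree x y ((z t) (u v)) rooted at 6.
withoutD : Witness
withoutD = witness
  (# 6 ∷ # 6 ∷ # 7 ∷ # 7 ∷ # 9 ∷ # 9 ∷ # 6 ∷ # 8 ∷ # 6 ∷ # 8 ∷ [])
  ( just (# 6 ∷ # 7 ∷ # 1 ∷ # 5 ∷ [])
  ∷ just (# 6 ∷ # 8 ∷ # 2 ∷ # 4 ∷ [])
  ∷ just (# 6 ∷ # 9 ∷ # 0 ∷ # 3 ∷ [])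
  ∷ nothing
  ∷ just (# 7 ∷ # 9 ∷ # 0 ∷ # 1 ∷ [])
  ∷ [])

-- Without e: the tree y z ((x u) (t v)) rooted at 6.
withoutE : Witness
withoutE = witness
  (# 8 ∷ # 6 ∷ # 6 ∷ # 9 ∷ # 8 ∷ # 9 ∷ # 6 ∷ # 6 ∷ # 7 ∷ # 7 ∷ [])
  ( just (# 8 ∷ # 6 ∷ # 1 ∷ # 5 ∷ [])
  ∷ just (# 6 ∷ # 9 ∷ # 2 ∷ # 4 ∷ [])
  ∷ just (# 6 ∷ # 7 ∷ # 0 ∷ # 3 ∷ [])
  ∷ just (# 8 ∷ # 6 ∷ # 3 ∷ # 5 ∷ [])
  ∷ nothing
  ∷ [])

witnesses : Vec Witness 5
witnesses = withoutA ∷ withoutB ∷ withoutC ∷ withoutD ∷ withoutE ∷ []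

Valid : Fin 5 → Set
Valid i = WellShaped × ((j : Fin 5) → j ≡ i ⊎ Certified (chars j) (lookup tops j))
  where open Witness (lookup witnesses i); open Shape parents

valid? : (i : Fin 5) → Dec (Valid i)
valid? i = wellShaped? ×-dec all? (λ j → j ≟ i ⊎-dec certified? (chars j) (lookup tops j))
  where open Witness (lookup witnesses i); open Shape parents

compatibleWithout : (i : Fin 5) → Valid i → Compatible {Σ (Fin 5) (λ j → j ≢ i)} (λ j → chars (proj₁ j))
compatibleWithout i (shape , certified) = phyloTree shape , convex
  where
  open Witness (lookup witnesses i)
  open Shape parents
  convex : (j : Σ (Fin 5) (λ j → j ≢ i)) → Convex (phyloTree shape) (chars (proj₁ j))
  convex (j , j≢i) with certified j
  ... | inj₁ j≡i  = ⊥-elim (j≢i j≡i)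
  ... | inj₂ cert = certified⇒convex′ shape (lookup tops j) cert

mainTheorem1 : ¬ Compatible chars
    × ((i : Fin 5) → Compatible {Σ (Fin 5) (λ j → j ≢ i)} (λ j → chars (Σ.proj₁ j)))
mainTheorem1 = incompatible , λ i → compatibleWithout i (from-yes (all? valid?) i)
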